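{- Let $\Omega$ and $\Gamma$ be finite sets, let $K$ be a positive integer, and let $\mathcal{X}$ be a flat distribution on $\Omega$ with min-entropy $\log K$ (i.e., $\mathcal{X}$ is uniform on a set $\mathrm{supp}(\mathcal{X})\subseteq \Omega$ of size $K$). Let $f\colon \Omega\to\Gamma$ be a mapping and $\epsilon\ge 0$. If the distribution $f(\mathcal{X})$ is $\epsilon$-close to a distribution on $\Gamma$ with min-entropy $\log K$, then there is a set $T\subseteq \Gamma$ with $|T|\ge (1-2\epsilon)K$ such that for every $y\in T$ and all $x,x'\in \mathrm{supp}(\mathcal{X})$, if $f(x)=y$ and $f(x')=y$ then $x=x'$.
   Context: The min-entropy of a distribution $\mathcal{Y}$ on a finite set is $H_\infty(\mathcal{Y})=\min_{s\in\mathrm{supp}(\mathcal{Y})}\{ -\log_2 \mathcal{Y}(s)\}$. A distribution is flat if it is uniform on its support. Two distributions $\mathcal{Y},\mathcal{Y}'$ on the same finite set $\Gamma$ are $\epsilon$-close if $\frac12\sum_{s\in\Gamma}|\mathcal{Y}(s)-\mathcal{Y}'(s)|\le\epsilon$. $f(\mathcal{X})$ denotes the distribution of $f(X)$ for $X\sim\mathcal{X}$.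
   Formalization: The parameter $\epsilon$ is rational, and the distribution on Γ with min-entropy $\log K$ to which $f(\mathcal{X})$ is $\epsilon$-close takes values in the rationals. -}

module Defs where

open import Data.Nat as ℕ using (ℕ; zero; suc; NonZero)
open import Data.Integer using (+_)
open import Data.Fin using (Fin; _≟_)
open import Data.Rational using (ℚ; 0ℚ; 1ℚ; _+_; _*_; _-_; _/_; ∣_∣; _≤_; _<_; ½)
open import Data.Product using (Σ; _×_; ∃)
open import Relation.Nullary using (yes; no)
open import Relation.Binary.PropositionalEquality using (_≡_)

∑ : ∀ {n} → (Fin n → ℚ) → ℚ
∑ {zero}  f = 0ℚ
∑ {suc n} f = f Fin.zero + ∑ (λ i → f (Fin.suc i))

Dist : ℕ → Set
Dist n = Fin n → ℚ

IsDistribution : ∀ {n} → Dist n → Set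
IsDistribution Y = (∀ s → 0ℚ ≤ Y s) × (∑ Y ≡ 1ℚ)

InSupp : ∀ {n} → Dist n → Fin n → Set
InSupp Y s = 0ℚ < Y s

IsFlat : ∀ {n} → Dist n → Set
IsFlat Y = ∀ s t → InSupp Y s → InSupp Y t → Y s ≡ Y t

ℕtoℚ : ℕ → ℚ
ℕtoℚ k = + k / 1

-- H∞(Y) = log₂ K, i.e. min_{s ∈ supp Y} (-log₂ Y(s)) = log₂ K, i.e.
-- max_{s ∈ supp Y} Y(s) = 1/K : every support point has probability ≤ 1/K
-- and some support point has probability exactly 1/K.
HasMinEntropyLog : ∀ {n} (K : ℕ) .{{_ : NonZero K}} → Dist n → Set
HasMinEntropyLog K Y =
  (∀ s → InSupp Y s → Y s ≤ + 1 / K) × ∃ (λ s → InSupp Y s × Y s ≡ + 1 / K)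

push : ∀ {n m} → (Fin n → Fin m) → Dist n → Dist m
push f X y = ∑ (λ x → indicator x)
  where
  indicator : _ → ℚ
  indicator x with f x ≟ y
  ... | yes _ = X x
  ... | no  _ = 0ℚ

statDist : ∀ {m} → Dist m → Dist m → ℚ
statDist Y Y' = ½ * ∑ (λ s → ∣ Y s - Y' s ∣)

Close : ∀ {m} → ℚ → Dist m → Dist m → Set
Close ε Y Y' = statDist Y Y' ≤ ε

{-# OPTIONS --safe #-}
-- Let T be the set of points y with f(𝒳)(y) < 2/K. Two distinct support points
-- of 𝒳 in the fibre over y would give f(𝒳)(y) ≥ 2/K, so f is injective on the
-- support over T. For the size of T, let 𝒴 be the nearby distribution: every
-- 𝒴(y) is at most 1/K, and outside T we have f(𝒳)(y) ≥ 2/K ≥ 2𝒴(y), hence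
-- 𝒴(y) ≤ |f(𝒳)(y) − 𝒴(y)|. Summing over y gives 1 ≤ 2ε + |T|/K.
module Submission where

open import Defs
open import Data.Nat using (ℕ; NonZero)
open import Data.Integer using (+_)
open import Data.Fin using (Fin)
open import Data.Fin.Subset using (Subset; _∈_; ∣_∣)
open import Data.Rational using (ℚ; 0ℚ; 1ℚ; _*_; _-_; _/_; _≤_)
open import Data.Product using (_×_; ∃; _,_)
open import Relation.Binary.PropositionalEquality using (_≡_)

import Data.Nat as ℕ
import Data.Integer as ℤ
import Data.Integer.Properties as ℤ
open import Data.Fin using (zero; suc; _≟_)
open import Data.Rational using (NonNegative; _+_; -_; _<_; ½; mkℚ; _<?_) renaming (∣_∣ to abs)
open import Data.Rational.Properties hiding (_≟_)
open import Data.Rational.Solver using (module +-*-Solver)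
import Data.Nat.Coprimality as Coprimality
open import Data.Bool using (Bool; true; false; if_then_else_)
open import Data.Vec using (tabulate)
open import Data.Vec.Properties using ([]=⇒lookup; lookup∘tabulate)
open import Data.Sum using (inj₁; inj₂)
open import Relation.Nullary using (¬_; Dec; yes; no; does; contradiction)
open import Relation.Binary.PropositionalEquality
  using (refl; sym; trans; cong; cong₂; _≢_; module ≡-Reasoning)

open +-*-Solver

p≤q+p : ∀ {p q} → 0ℚ ≤ q → p ≤ q + p
p≤q+p {p} {q} 0≤q = ≤-trans (≤-reflexive (sym (+-identityˡ p))) (+-monoˡ-≤ p 0≤q)

p≤p+q : ∀ {p q} → 0ℚ ≤ q → p ≤ p + q
p≤p+q {p} {q} 0≤q = ≤-trans (≤-reflexive (sym (+-identityʳ p))) (+-monoʳ-≤ p 0≤q)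

p≤∣p∣ : ∀ p → p ≤ abs p
p≤∣p∣ p with ≤-total 0ℚ p
... | inj₁ 0≤p = ≤-reflexive (sym (0≤p⇒∣p∣≡p 0≤p))
... | inj₂ p≤0 = ≤-trans p≤0 (0≤∣p∣ p)

≤⇒≯ : ∀ {p q} → p ≤ q → ¬ (q < p)
≤⇒≯ p≤q q<p = <-irrefl refl (<-≤-trans q<p p≤q)

∑-cong : ∀ {n} {g h : Fin n → ℚ} → (∀ i → g i ≡ h i) → ∑ g ≡ ∑ h
∑-cong {ℕ.zero}  g≡h = refl
∑-cong {ℕ.suc n} g≡h = cong₂ _+_ (g≡h zero) (∑-cong λ i → g≡h (suc i))

∑-mono-≤ : ∀ {n} {g h : Fin n → ℚ} → (∀ i → g i ≤ h i) → ∑ g ≤ ∑ h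
∑-mono-≤ {ℕ.zero}  g≤h = ≤-refl
∑-mono-≤ {ℕ.suc n} g≤h = +-mono-≤ (g≤h zero) (∑-mono-≤ λ i → g≤h (suc i))

∑-distrib-+ : ∀ {n} (g h : Fin n → ℚ) → ∑ (λ i → g i + h i) ≡ ∑ g + ∑ h
∑-distrib-+ {ℕ.zero}  g h = refl
∑-distrib-+ {ℕ.suc n} g h = begin
  (g zero + h zero) + ∑ (λ i → g (suc i) + h (suc i))
    ≡⟨ cong (λ t → (g zero + h zero) + t) (∑-distrib-+ (λ i → g (suc i)) (λ i → h (suc i))) ⟩
  (g zero + h zero) + (∑ (λ i → g (suc i)) + ∑ (λ i → h (suc i)))
    ≡⟨ interchange (g zero) (h zero) _ _ ⟩
  (g zero + ∑ (λ i → g (suc i))) + (h zero + ∑ (λ i → h (suc i))) ∎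
  where
  open ≡-Reasoning
  interchange : ∀ a b c d → (a + b) + (c + d) ≡ (a + c) + (b + d)
  interchange = solve 4 (λ a b c d → (a :+ b) :+ (c :+ d) := (a :+ c) :+ (b :+ d)) refl

∑-nonNeg : ∀ {n} {g : Fin n → ℚ} → (∀ i → 0ℚ ≤ g i) → 0ℚ ≤ ∑ g
∑-nonNeg {ℕ.zero}  0≤g = ≤-refl
∑-nonNeg {ℕ.suc n} 0≤g = +-mono-≤ (0≤g zero) (∑-nonNeg λ i → 0≤g (suc i))

term≤∑ : ∀ {n} {g : Fin n → ℚ} → (∀ i → 0ℚ ≤ g i) → ∀ i → g i ≤ ∑ g
term≤∑ 0≤g zero    = p≤p+q (∑-nonNeg λ i → 0≤g (suc i))
term≤∑ 0≤g (suc i) = ≤-trans (term≤∑ (λ j → 0≤g (suc j)) i) (p≤q+p (0≤g zero))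

pair≤∑ : ∀ {n} {g : Fin n → ℚ} → (∀ i → 0ℚ ≤ g i) → ∀ i j → i ≢ j → g i + g j ≤ ∑ g
pair≤∑ 0≤g zero zero i≢j = contradiction refl i≢j
pair≤∑ {g = g} 0≤g zero (suc j) i≢j = +-monoʳ-≤ (g zero) (term≤∑ (λ k → 0≤g (suc k)) j)
pair≤∑ {g = g} 0≤g (suc i) zero i≢j =
  ≤-trans (≤-reflexive (+-comm (g (suc i)) (g zero))) (pair≤∑ 0≤g zero (suc i) (λ e → i≢j (sym e)))
pair≤∑ 0≤g (suc i) (suc j) i≢j =
  ≤-trans (pair≤∑ (λ k → 0≤g (suc k)) i j (λ e → i≢j (cong suc e))) (p≤q+p (0≤g zero))

coprimeTo1 : ∀ k → Coprimality.Coprime k 1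
coprimeTo1 k = Coprimality.sym (Coprimality.1-coprimeTo k)

ℕtoℚ≡mkℚ : ∀ k → ℕtoℚ k ≡ mkℚ (+ k) 0 (coprimeTo1 k)
ℕtoℚ≡mkℚ k = normalize-coprime (coprimeTo1 k)

ℕtoℚ-suc : ∀ k → ℕtoℚ (ℕ.suc k) ≡ 1ℚ + ℕtoℚ k
ℕtoℚ-suc k = begin
  + ℕ.suc k / 1                    ≡⟨ cong (λ z → (+ 1 ℤ.+ z) / 1) (sym (ℤ.*-identityʳ (+ k))) ⟩
  (+ 1 ℤ.+ + k ℤ.* + 1) / 1        ≡⟨⟩
  1ℚ + mkℚ (+ k) 0 (coprimeTo1 k)  ≡⟨ cong (_+_ 1ℚ) (sym (ℕtoℚ≡mkℚ k)) ⟩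
  1ℚ + ℕtoℚ k                      ∎
  where open ≡-Reasoning

1/K*K≡1 : ∀ K .{{_ : NonZero K}} → (+ 1 / K) * ℕtoℚ K ≡ 1ℚ
1/K*K≡1 (ℕ.suc k) = begin
  (+ 1 / ℕ.suc k) * ℕtoℚ (ℕ.suc k)
    ≡⟨ cong₂ _*_ (normalize-coprime (Coprimality.1-coprimeTo (ℕ.suc k))) (ℕtoℚ≡mkℚ (ℕ.suc k)) ⟩
  mkℚ (+ 1) k (Coprimality.1-coprimeTo (ℕ.suc k)) * mkℚ (+ ℕ.suc k) 0 (coprimeTo1 (ℕ.suc k))
    ≡⟨ *-inverseˡ (mkℚ (+ ℕ.suc k) 0 (coprimeTo1 (ℕ.suc k))) ⟩
  1ℚ ∎
  where open ≡-Reasoning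

∑-indicator : ∀ {m} (b : Fin m → Bool) q →
  ∑ (λ y → if b y then q else 0ℚ) ≡ ℕtoℚ ∣ tabulate b ∣ * q
∑-indicator {ℕ.zero}  b q = sym (*-zeroˡ q)
∑-indicator {ℕ.suc m} b q with b zero
... | true  = begin
  q + ∑ (λ y → if b (suc y) then q else 0ℚ) ≡⟨ cong (_+_ q) (∑-indicator (λ y → b (suc y)) q) ⟩
  q + c * q                                  ≡⟨ cong (_+ c * q) (sym (*-identityˡ q)) ⟩
  1ℚ * q + c * q                             ≡⟨ sym (*-distribʳ-+ q 1ℚ c) ⟩
  (1ℚ + c) * q                               ≡⟨ cong (_* q) (sym (ℕtoℚ-suc ∣ tabulate (λ y → b (suc y)) ∣)) ⟩
  ℕtoℚ (ℕ.suc ∣ tabulate (λ y → b (suc y)) ∣) * q ∎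
  where
  open ≡-Reasoning
  c : ℚ
  c = ℕtoℚ ∣ tabulate (λ y → b (suc y)) ∣
... | false = trans (+-identityˡ (∑ (λ y → if b (suc y) then q else 0ℚ))) (∑-indicator (λ y → b (suc y)) q)

fibreMass : ∀ {n m} → (Fin n → Fin m) → Dist n → Fin m → Fin n → ℚ
fibreMass f X y x = if does (f x ≟ y) then X x else 0ℚ

-- The summand of `push` is local to Defs and cannot be named here; the type
-- of `push-summand` is left to be inferred from its use in `push-∑`.
mutual
  push-∑ : ∀ {n m} (f : Fin n → Fin m) X y → push f X y ≡ ∑ (fibreMass f X y)
  push-∑ f X y = ∑-cong (push-summand f X y)

  push-summand : ∀ {n m} (f : Fin n → Fin m) X y x → _ ≡ fibreMass f X y x
  push-summand f X y x with f x ≟ y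
  ... | yes _ = refl
  ... | no  _ = refl

fibreMass-nonNeg : ∀ {n m} (f : Fin n → Fin m) {X} y → (∀ x → 0ℚ ≤ X x) → ∀ x → 0ℚ ≤ fibreMass f X y x
fibreMass-nonNeg f y 0≤X x with f x ≟ y
... | yes _ = 0≤X x
... | no  _ = ≤-refl

fibreMass-onFibre : ∀ {n m} (f : Fin n → Fin m) X {y x} → f x ≡ y → fibreMass f X y x ≡ X x
fibreMass-onFibre f X {y} {x} fx≡y with f x ≟ y
... | yes _    = refl
... | no fx≢y = contradiction fx≡y fx≢y

push-≥-fibre-pair : ∀ {n m} (f : Fin n → Fin m) {X} {y x x′} → (∀ x → 0ℚ ≤ X x) →
  f x ≡ y → f x′ ≡ y → x ≢ x′ → X x + X x′ ≤ push f X y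
push-≥-fibre-pair f {X} {y} {x} {x′} 0≤X fx≡y fx′≡y x≢x′ = begin
  X x + X x′                                ≡⟨ sym (cong₂ _+_ (fibreMass-onFibre f X fx≡y) (fibreMass-onFibre f X fx′≡y)) ⟩
  fibreMass f X y x + fibreMass f X y x′    ≤⟨ pair≤∑ (fibreMass-nonNeg f y 0≤X) x x′ x≢x′ ⟩
  ∑ (fibreMass f X y)                       ≡⟨ sym (push-∑ f X y) ⟩
  push f X y                                ∎
  where open ≤-Reasoning

lowMass : ∀ {m} → Dist m → ℚ → Subset m
lowMass P a = tabulate (λ y → does (P y <? a + a))

does≡true⇒ : ∀ {ℓ} {A : Set ℓ} (A? : Dec A) → does A? ≡ true → A
does≡true⇒ (yes a) _ = a

∈lowMass⇒< : ∀ {m} (P : Dist m) a {y} → y ∈ lowMass P a → P y < a + a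
∈lowMass⇒< P a {y} y∈T =
  does≡true⇒ (P y <? a + a) (trans (sym (lookup∘tabulate _ y)) ([]=⇒lookup y∈T))

q≤∣p-q∣+lowWeight : ∀ {p q a} → 0ℚ ≤ q → q ≤ a → (p<2a? : Dec (p < a + a)) →
  q ≤ abs (p - q) + (if does p<2a? then a else 0ℚ)
q≤∣p-q∣+lowWeight {p} {q} 0≤q q≤a (yes _) = ≤-trans q≤a (p≤q+p (0≤∣p∣ (p - q)))
q≤∣p-q∣+lowWeight {p} {q} 0≤q q≤a (no p≮2a) = begin
  q                  ≡⟨ solve 1 (λ q → q := (q :+ q) :- q) refl q ⟩
  (q + q) - q        ≤⟨ +-monoˡ-≤ (- q) (≤-trans (+-mono-≤ q≤a q≤a) (≮⇒≥ p≮2a)) ⟩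
  p - q              ≤⟨ p≤∣p∣ (p - q) ⟩
  abs (p - q)        ≡⟨ sym (+-identityʳ (abs (p - q))) ⟩
  abs (p - q) + 0ℚ   ∎
  where open ≤-Reasoning

∑≤deviation+lowMass : ∀ {m} (P Y : Dist m) {a} → (∀ s → 0ℚ ≤ Y s) → (∀ s → Y s ≤ a) →
  ∑ Y ≤ ∑ (λ s → abs (P s - Y s)) + ℕtoℚ ∣ lowMass P a ∣ * a
∑≤deviation+lowMass P Y {a} 0≤Y Y≤a = begin
  ∑ Y                                  ≤⟨ ∑-mono-≤ (λ s → q≤∣p-q∣+lowWeight (0≤Y s) (Y≤a s) (P s <? a + a)) ⟩
  ∑ (λ s → deviation s + lowWeight s)  ≡⟨ ∑-distrib-+ deviation lowWeight ⟩
  ∑ deviation + ∑ lowWeight            ≡⟨ cong (_+_ (∑ deviation)) (∑-indicator (λ s → does (P s <? a + a)) a) ⟩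
  ∑ deviation + ℕtoℚ ∣ lowMass P a ∣ * a ∎
  where
  open ≤-Reasoning
  deviation lowWeight : Fin _ → ℚ
  deviation s = abs (P s - Y s)
  lowWeight s = if does (P s <? a + a) then a else 0ℚ

lowMass-fibre-injective : ∀ {n m} (f : Fin n → Fin m) {X : Dist n} {a y} →
  (∀ x → 0ℚ ≤ X x) → (∀ x → InSupp X x → X x ≡ a) → y ∈ lowMass (push f X) a →
  ∀ x x′ → InSupp X x → InSupp X x′ → f x ≡ y → f x′ ≡ y → x ≡ x′
lowMass-fibre-injective f {X} {a} {y} 0≤X X≡a y∈T x x′ x∈X x′∈X fx≡y fx′≡y with x ≟ x′
... | yes x≡x′ = x≡x′
... | no  x≢x′ = contradiction (∈lowMass⇒< (push f X) a y∈T) (≤⇒≯ (begin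
  a + a          ≡⟨ sym (cong₂ _+_ (X≡a x x∈X) (X≡a x′ x′∈X)) ⟩
  X x + X x′     ≤⟨ push-≥-fibre-pair f 0≤X fx≡y fx′≡y x≢x′ ⟩
  push f X y     ∎))
  where open ≤-Reasoning

flat⇒uniformOnSupp : ∀ {n} {X : Dist n} {K} .{{_ : NonZero K}} → IsFlat X → HasMinEntropyLog K X →
  ∀ x → InSupp X x → X x ≡ + 1 / K
flat⇒uniformOnSupp flat (_ , s , s∈X , Xs≡1/K) x x∈X = trans (flat x s x∈X s∈X) Xs≡1/K

minEntropy⇒≤ : ∀ {m} {Y : Dist m} {K} .{{_ : NonZero K}} → HasMinEntropyLog K Y → ∀ s → Y s ≤ + 1 / K
minEntropy⇒≤ {Y = Y} {K} (Y≤1/K , _) s with 0ℚ <? Y s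
... | yes s∈Y = Y≤1/K s s∈Y
... | no  s∉Y = ≤-trans (≮⇒≥ s∉Y) (nonNegative⁻¹ (+ 1 / K) {{normalize-nonNeg 1 K}})

½*p≤q⇒p≤2*q : ∀ {p q} → ½ * p ≤ q → p ≤ + 2 / 1 * q
½*p≤q⇒p≤2*q {p} {q} ½p≤q = begin
  p                 ≡⟨ solve 1 (λ p → p := con (+ 2 / 1) :* (con ½ :* p)) refl p ⟩
  + 2 / 1 * (½ * p) ≤⟨ *-monoˡ-≤-nonNeg (+ 2 / 1) {{normalize-nonNeg 2 1}} ½p≤q ⟩
  + 2 / 1 * q       ∎
  where open ≤-Reasoning

≤-scaleByInverse : ∀ {p t a k} .{{_ : NonNegative k}} → a * k ≡ 1ℚ → p ≤ t * a → p * k ≤ t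
≤-scaleByInverse {p} {t} {a} {k} a*k≡1 p≤t*a = begin
  p * k        ≤⟨ *-monoʳ-≤-nonNeg k p≤t*a ⟩
  t * a * k    ≡⟨ *-assoc t a k ⟩
  t * (a * k)  ≡⟨ cong (t *_) a*k≡1 ⟩
  t * 1ℚ       ≡⟨ *-identityʳ t ⟩
  t            ∎
  where open ≤-Reasoning

p≤q+r⇒p-s≤r : ∀ {p q r s} → p ≤ q + r → q ≤ s → p - s ≤ r
p≤q+r⇒p-s≤r {p} {q} {r} {s} p≤q+r q≤s = begin
  p - s         ≤⟨ +-monoʳ-≤ p (neg-antimono-≤ q≤s) ⟩
  p - q         ≤⟨ +-monoˡ-≤ (- q) p≤q+r ⟩
  (q + r) - q   ≡⟨ solve 2 (λ q r → (q :+ r) :- q := r) refl q r ⟩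
  r             ∎
  where open ≤-Reasoning

proposition2 : (n m K : ℕ) .{{_ : NonZero K}} (X : Dist n) (f : Fin n → Fin m) (ε : ℚ)
    → IsDistribution X → IsFlat X → HasMinEntropyLog K X
    → 0ℚ ≤ ε
    → (∃ λ (Y : Dist m) → IsDistribution Y × HasMinEntropyLog K Y × Close ε (push f X) Y)
    → ∃ λ (T : Subset m) → ((1ℚ - + 2 / 1 * ε) * ℕtoℚ K ≤ ℕtoℚ ∣ T ∣)
        × (∀ y → y ∈ T → ∀ x x′ → InSupp X x → InSupp X x′ → f x ≡ y → f x′ ≡ y → x ≡ x′)
proposition2 n m K X f ε (0≤X , _) flat H∞X _ (Y , (0≤Y , ∑Y≡1) , H∞Y , close) =
  T , large , λ y y∈T → lowMass-fibre-injective f 0≤X (flat⇒uniformOnSupp flat H∞X) y∈T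
  where
  S : ℚ
  S = ∑ (λ s → abs (push f X s - Y s))
  T : Subset m
  T = lowMass (push f X) (+ 1 / K)
  covered : 1ℚ ≤ S + ℕtoℚ ∣ T ∣ * (+ 1 / K)
  covered = ≤-trans (≤-reflexive (sym ∑Y≡1)) (∑≤deviation+lowMass (push f X) Y 0≤Y (minEntropy⇒≤ H∞Y))
  large : (1ℚ - + 2 / 1 * ε) * ℕtoℚ K ≤ ℕtoℚ ∣ T ∣
  large = ≤-scaleByInverse {a = + 1 / K} {{normalize-nonNeg K 1}} (1/K*K≡1 K)
            (p≤q+r⇒p-s≤r {q = S} covered (½*p≤q⇒p≤2*q close))
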